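{- Let $A$ be a set with relations $<, \leq\, : A \to A \to \mathsf{hProp}$ satisfying: (A1) $<$ is transitive and irreflexive; (A2) $\leq$ is reflexive, transitive and antisymmetric; (A3) for all $a,b,c$, $b < a \to b \leq a$, and $c < b \to b \leq a \to c < a$. Assume that $(A,<,\leq)$ has classification, i.e.\ for every $a : A$ we have $\mathsf{is\text{ - }zero}(a) \uplus \mathsf{is\text{ - }str\text{ - }suc}(a) \uplus \mathsf{is\text{ - }limit}(a)$, and that $(A,<)$ satisfies transfinite induction, i.e.\ for every family $P : A \to \mathcal{U}$ with $\forall a.\,(\forall b.\, b < a \to P(b)) \to P(a)$ we have $\forall a. P(a)$. Then $(A,<,\leq)$ satisfies classifiability induction: for every family $P : A \to \mathsf{hProp}$ such that (i) $\mathsf{is\text{ - }zero}(a) \to P(a)$ for all $a$, (ii) $(a \text{ is-str-suc-of } b) \to P(b) \to P(a)$ for all $a, b$, and (iii) $(a \text{ is-sup-of } f) \to (\forall i. P(f(i))) \to P(a)$ for all $a$ and all increasing $f : \mathbb{N} \to_{<} A$, we have $\forall a. P(a)$.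
   Context: Work in homotopy type theory; $\mathsf{hProp}$ is the type of propositions, $\mathcal{U}$ a universe, $\exists$ the propositional truncation of a $\Sigma$-type. Definitions: $\mathsf{is\text{ - }zero}(a) := \forall b.\, a \leq b$. $a \text{ is-suc-of } b := (b < a) \times \forall x.\,(b < x \to a \leq x)$. $a \text{ is-str-suc-of } b := (a \text{ is-suc-of } b) \times \forall x.\,(x < a \to x \leq b)$. $\mathsf{is\text{ - }str\text{ - }suc}(a) := \Sigma(b:A).\, a \text{ is-str-suc-of } b$. For $f : \mathbb{N} \to A$, $a \text{ is-sup-of } f := (\forall i. f(i) \leq a) \times \forall x.\,((\forall i. f(i) \leq x) \to a \leq x)$. $\mathbb{N} \to_{<} A$ is the type of sequences $f$ with $\forall k. f(k) < f(k+1)$. $\mathsf{is\text{ - }limit}(a) := \exists(f : \mathbb{N} \to_{<} A).\, a \text{ is-sup-of } f$. -}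

module Defs where

open import Level using (Level; _⊔_; suc)
open import Data.Nat using (ℕ) renaming (suc to sucℕ)
open import Data.Product using (Σ; _×_; Σ-syntax)
open import Data.Sum using (_⊎_)
import Data.Empty
open import Relation.Binary.PropositionalEquality using (_≡_)

isProp : ∀ {ℓ} → Set ℓ → Set ℓ
isProp X = (x y : X) → x ≡ y

isSet : ∀ {ℓ} → Set ℓ → Set ℓ
isSet X = (x y : X) → isProp (x ≡ y)

-- Propositional truncation, impredicative (universal property) encoding:
-- eliminates into every proposition of level ℓ.
∥_∥ : ∀ {ℓ} → Set ℓ → Set (suc ℓ)
∥_∥ {ℓ} X = (Q : Set ℓ) → isProp Q → (X → Q) → Q

module Ordinals {ℓ : Level} {A : Set ℓ} (_<_ _≤_ : A → A → Set ℓ) where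

  is-zero : A → Set ℓ
  is-zero a = ∀ b → a ≤ b

  _is-suc-of_ : A → A → Set ℓ
  a is-suc-of b = (b < a) × (∀ x → b < x → a ≤ x)

  _is-str-suc-of_ : A → A → Set ℓ
  a is-str-suc-of b = (a is-suc-of b) × (∀ x → x < a → x ≤ b)

  is-str-suc : A → Set ℓ
  is-str-suc a = Σ[ b ∈ A ] (a is-str-suc-of b)

  _is-sup-of_ : A → (ℕ → A) → Set ℓ
  a is-sup-of f = (∀ i → f i ≤ a) × (∀ x → (∀ i → f i ≤ x) → a ≤ x)

  IncSeq : Set ℓ
  IncSeq = Σ[ f ∈ (ℕ → A) ] (∀ k → f k < f (sucℕ k))

  is-limit : A → Set (suc ℓ)
  is-limit a = ∥ Σ[ f ∈ IncSeq ] (a is-sup-of Σ.proj₁ f) ∥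

  has-classification : Set (suc ℓ)
  has-classification = ∀ a → is-zero a ⊎ is-str-suc a ⊎ is-limit a

  transfinite-induction : Set (suc ℓ)
  transfinite-induction =
    (P : A → Set ℓ) → (∀ a → (∀ b → b < a → P b) → P a) → ∀ a → P a

  classifiability-induction : Set (suc ℓ)
  classifiability-induction =
    (P : A → Set ℓ) → (∀ a → isProp (P a))
    → (∀ a → is-zero a → P a)
    → (∀ a b → a is-str-suc-of b → P b → P a)
    → (∀ (a : A) (f : IncSeq) → a is-sup-of Σ.proj₁ f → (∀ i → P (Σ.proj₁ f i)) → P a)
    → ∀ a → P a

  record IsOrdStructure : Set ℓ where
    field
      A-set     : isSet A
      <-prop    : ∀ a b → isProp (a < b)
      ≤-prop    : ∀ a b → isProp (a ≤ b)
      <-trans   : ∀ a b c → a < b → b < c → a < c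
      <-irrefl  : ∀ a → a < a → Data.Empty.⊥
      ≤-refl    : ∀ a → a ≤ a
      ≤-trans   : ∀ a b c → a ≤ b → b ≤ c → a ≤ c
      ≤-antisym : ∀ a b → a ≤ b → b ≤ a → a ≡ b
      <⇒≤       : ∀ a b → b < a → b ≤ a
      <-≤-trans : ∀ a b c → c < b → b ≤ a → c < a

{-# OPTIONS --safe #-}
module Submission where

open import Defs
open import Level using (Level)
open import Data.Nat using () renaming (suc to sucℕ)
open import Data.Product using (_,_; proj₁)
open import Data.Sum using (inj₁; inj₂)

-- Transfinite induction, split by the classification of the current point: a
-- strict successor lies above its predecessor, a limit above every term of its
-- sequence, and the truncated sequence may be unpacked since P a is a proposition.

module _ {ℓ : Level} {A : Set ℓ} (_<_ _≤_ : A → A → Set ℓ) where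

  open Ordinals _<_ _≤_

  str-suc-of⇒> : ∀ {a b} → a is-str-suc-of b → b < a
  str-suc-of⇒> ((b<a , _) , _) = b<a

module _ {ℓ : Level} {A : Set ℓ} (_<_ _≤_ : A → A → Set ℓ)
         (S : Ordinals.IsOrdStructure _<_ _≤_) where

  open Ordinals _<_ _≤_
  open IsOrdStructure S

  -- f i < f (i + 1) ≤ a
  inc-seq-<-sup : ∀ {a} (f : IncSeq) → a is-sup-of proj₁ f → ∀ i → proj₁ f i < a
  inc-seq-<-sup {a} (f , inc) (ub , _) i = <-≤-trans a (f (sucℕ i)) (f i) (inc i) (ub (sucℕ i))

theorem4p12 : ∀ {ℓ : Level} {A : Set ℓ} (_<_ _≤_ : A → A → Set ℓ)
    → Ordinals.IsOrdStructure _<_ _≤_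
    → Ordinals.has-classification _<_ _≤_
    → Ordinals.transfinite-induction _<_ _≤_
    → Ordinals.classifiability-induction _<_ _≤_
theorem4p12 _<_ _≤_ S classify ti P P-prop zero-case suc-case lim-case = ti P step
  where
  step : ∀ a → (∀ b → b < a → P b) → P a
  step a ih with classify a
  ... | inj₁ a-zero = zero-case a a-zero
  ... | inj₂ (inj₁ (b , a-suc-b)) =
    suc-case a b a-suc-b (ih b (str-suc-of⇒> _<_ _≤_ a-suc-b))
  ... | inj₂ (inj₂ a-limit) = a-limit (P a) (P-prop a) λ where
    (f , a-sup-f) → lim-case a f a-sup-f
      (λ i → ih (proj₁ f i) (inc-seq-<-sup _<_ _≤_ S f a-sup-f i))
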